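{- Let $n>1$ be an integer. Then the rational function $$G_n(y):=y\cdot\frac{T_n\big(\frac1{2y}\big)}{T_{n-1}\big(\frac1{2y}\big)},$$ expanded as a formal power series in $y$, and the formal power series $$1-c_0y^2-c_1y^4-c_2y^6-c_3y^8-\ldots=1-\sum_{k\ge0}c_ky^{2k+2}$$ have the same coefficients of $y^j$ for all $0\le j\le 2n-4$.
   Context: For $n\ge1$, $T_n(x)$ denotes the $n$-th Chebyshev polynomial of the first kind, i.e. the polynomial satisfying $T_n(\cos t)=\cos(nt)$ for all real $t$; equivalently $T_1(x)=x$, $T_2(x)=2x^2-1$ and $T_{n+1}(x)=2xT_n(x)-T_{n-1}(x)$ for $n\ge2$. The $k$-th Catalan number $c_k$ is the number of correct bracket sequences consisting of $k$ pairs of brackets, so $c_0=c_1=1$, $c_2=2$, $c_3=5,\ldots$. (The rational function $G_n(y)$ has a nonzero value at $y=0$ after clearing negative powers, so it expands as a formal power series in $y$.) -}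

module Defs where

open import Data.Nat using (ℕ; zero; suc; _∸_; _≤ᵇ_)
open import Data.Bool using (Bool; true; false; if_then_else_)
open import Data.List using (List; []; _∷_; map; _++_; filter; length)
open import Data.Integer using (+_)
open import Data.Rational using (ℚ; 0ℚ; 1ℚ; ½; _+_; _*_; -_; _/_)
open import Relation.Nullary.Decidable using (⌊_⌋)
open import Data.Bool using (T)
open import Data.Bool.Properties using (T?)

-- Polynomials / formal power series over ℚ as coefficient functions:
-- p k = coefficient of x^k (resp. y^k).

Poly : Set
Poly = ℕ → ℚ

Series : Set
Series = ℕ → ℚ

const : ℚ → Poly
const c zero    = c
const c (suc _) = 0ℚ

shiftX : Poly → Poly
shiftX p zero    = 0ℚ
shiftX p (suc k) = p k

_⊕_ : Poly → Poly → Poly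
(p ⊕ q) k = p k + q k

_⊝_ : Poly → Poly → Poly
(p ⊝ q) k = p k + (- q k)

scale : ℚ → Poly → Poly
scale c p k = c * p k

two : ℚ
two = 1ℚ + 1ℚ

cheb : ℕ → Poly
cheb zero          = const 1ℚ
cheb (suc zero)    = shiftX (const 1ℚ)
cheb (suc (suc n)) = scale two (shiftX (cheb (suc n))) ⊝ cheb n

pow : ℚ → ℕ → ℚ
pow q zero    = 1ℚ
pow q (suc k) = q * pow q k

-- For a polynomial p of degree ≤ d, the polynomial y^d · p(1/(2y)):
-- its coefficient of y^j is p_{d-j} · (1/2)^{d-j} for j ≤ d, and 0 for j > d.
clearAt : ℕ → Poly → Series
clearAt d p j = if j ≤ᵇ d then p (d ∸ j) * pow ½ (d ∸ j) else 0ℚ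

sumTo : ℕ → (ℕ → ℚ) → ℚ
sumTo zero    f = f zero
sumTo (suc j) f = sumTo j f + f (suc j)

_⊛_ : Series → Series → Series
(f ⊛ g) j = sumTo j (λ i → f i * g (j ∸ i))

-- Catalan numbers: number of correct bracket sequences with k pairs.
-- true = "(" , false = ")".

-- balancedFrom d w : w closes correctly starting with d open brackets
balancedFrom : ℕ → List Bool → Bool
balancedFrom zero    []          = true
balancedFrom (suc _) []          = false
balancedFrom d       (true ∷ w)  = balancedFrom (suc d) w
balancedFrom zero    (false ∷ w) = false
balancedFrom (suc d) (false ∷ w) = balancedFrom d w

words : ℕ → List (List Bool)
words zero    = [] ∷ []
words (suc m) = map (true ∷_) (words m) ++ map (false ∷_) (words m)

catalan : ℕ → ℕ
catalan k = length (filter (λ w → T? (balancedFrom zero w)) (words (k Data.Nat.+ k)))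

toℚ : ℕ → ℚ
toℚ m = (+ m) / 1

-- even-indexed series: evenSeries f has coefficient f k at y^{2k}, 0 at odd powers
evenSeries : (ℕ → ℚ) → Series
evenSeries f zero          = f zero
evenSeries f (suc zero)    = 0ℚ
evenSeries f (suc (suc j)) = evenSeries (λ k → f (suc k)) j

-- 1 - Σ_{k≥0} c_k y^{2k+2}
catalanSeries : Series
catalanSeries zero          = 1ℚ
catalanSeries (suc zero)    = 0ℚ
catalanSeries (suc (suc j)) = - evenSeries (λ k → toℚ (catalan k)) j

-- The power series expansion of G_n(y) = y·T_n(1/(2y))/T_{n-1}(1/(2y)):
-- multiplying numerator and denominator by y^n gives
-- G_n = (y^n T_n(1/(2y))) / (y^{n-1} T_{n-1}(1/(2y))), a quotient of
-- polynomials whose denominator has constant term 1/2 ≠ 0.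
-- F is "the expansion of G_n" iff F · denominator = numerator.
IsExpansionOfG : ℕ → Series → Set
IsExpansionOfG n F = ∀ j → (F ⊛ clearAt (n ∸ 1) (cheb (n ∸ 1))) j ≡ clearAt n (cheb n) j
  where open import Relation.Binary.PropositionalEquality using (_≡_)

{-# OPTIONS --safe #-}
-- Write E m = y^m T_m(1/(2y)), so that E (m+2) = E (m+1) − y² E m with E 0 = 1 and E 1 = 1/2; the
-- expansion of G_n is the power series quotient E n / E (n−1), which exists and is unique because
-- E (n−1) has constant term 1/2. Let g d be the generating series of bracket words closing d open
-- brackets: g 0 = Σ c_k y^(2k), the Catalan series is 1 − y² g 0, and splitting off the first letter
-- gives g (d+1) = y g (d+2) + y g d. Hence both sides of
--   g 0 · E (m+1) − E m = y^(m+1) g (m+1) − ½ y^m g m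
-- satisfy the Chebyshev recurrence in m, so the identity follows from m = 0, 1. Its right side has
-- order ≥ 2m since g d has order ≥ d, so (1 − y² g 0) · E (n−1) agrees with E n below degree 2n − 2,
-- and dividing by E (n−1) gives the claim.
module Submission where

open import Defs
open import Data.Nat using (ℕ; _<_; _≤_; _∸_; _*_)
open import Data.Product using (Σ; _×_)
open import Relation.Binary.PropositionalEquality using (_≡_)

open import Data.Bool using (Bool; true; false; T)
open import Data.Bool.Properties using (T?)
import Data.Integer as ℤ
import Data.Integer.Properties as ℤₚ
open import Data.List using (List; []; _∷_; map; _++_; filter; length)
import Data.List.Properties as Listₚ
import Data.List.Relation.Unary.All as All
open import Data.Nat using (zero; suc; z≤n; s≤s; _≤?_; parity)
import Data.Nat as ℕ
open import Data.Nat.Coprimality using (1-coprimeTo)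
import Data.Nat.Coprimality as Coprimality
open import Data.Nat.Induction using (<-rec)
import Data.Nat.Properties as ℕₚ
open import Data.Parity.Base using (1ℙ; _⁻¹)
import Data.Parity.Properties as ℙₚ
open import Data.Product using (_,_; proj₁)
open import Data.Rational using (ℚ; 0ℚ; 1ℚ; ½; -_; _+_; _/_; mkℚ) renaming (_*_ to _·_)
import Data.Rational.Properties as ℚₚ
open import Algebra.Properties.Group ℚₚ.+-0-group using (x∙y⁻¹≈ε⇒x≈y)
open import Data.Rational.Solver using (module +-*-Solver)
open +-*-Solver using (solve; _:=_; _:+_; _:*_; :-_; con)
import Data.Sign as Sign
open import Data.Sum using (inj₁; inj₂)
open import Function using (_∘_)
open import Relation.Binary.PropositionalEquality
  using (_≗_; refl; sym; trans; cong; cong₂; subst; module ≡-Reasoning)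
open import Relation.Nullary using (yes; no; does; contradiction)
open import Relation.Unary using (Pred; Decidable)
open ≡-Reasoning

toℚ-+ : ∀ a b → toℚ (a ℕ.+ b) ≡ toℚ a + toℚ b
toℚ-+ a b = begin
  toℚ (a ℕ.+ b)                                      ≡⟨ cong₂ (λ x y → (x ℤ.+ y) / 1) (+≡◃ a) (+≡◃ b) ⟩
  ((Sign.+ ℤ.◃ a ℕ.* 1) ℤ.+ (Sign.+ ℤ.◃ b ℕ.* 1)) / 1 ≡⟨ cong₂ _+_ (toℚ≡mkℚ a) (toℚ≡mkℚ b) ⟨
  toℚ a + toℚ b                                      ∎
  where
  toℚ≡mkℚ : ∀ n → toℚ n ≡ mkℚ (ℤ.+ n) 0 (Coprimality.sym (1-coprimeTo n))
  toℚ≡mkℚ n = ℚₚ.normalize-coprime _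
  +≡◃ : ∀ n → ℤ.+ n ≡ Sign.+ ℤ.◃ n ℕ.* 1
  +≡◃ n = sym (trans (ℤₚ.+◃n≡+n _) (cong ℤ.+_ (ℕₚ.*-identityʳ n)))

-- Power series arithmetic

sumTo-cong : ∀ j {f g : ℕ → ℚ} → (∀ i → i ≤ j → f i ≡ g i) → sumTo j f ≡ sumTo j g
sumTo-cong zero    f≡g = f≡g 0 z≤n
sumTo-cong (suc j) f≡g =
  cong₂ _+_ (sumTo-cong j (λ i i≤j → f≡g i (ℕₚ.m≤n⇒m≤1+n i≤j))) (f≡g (suc j) ℕₚ.≤-refl)

sumTo-zero : ∀ j {f : ℕ → ℚ} → (∀ i → i ≤ j → f i ≡ 0ℚ) → sumTo j f ≡ 0ℚ
sumTo-zero zero    f≡0 = f≡0 0 z≤n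
sumTo-zero (suc j) f≡0 =
  cong₂ _+_ (sumTo-zero j (λ i i≤j → f≡0 i (ℕₚ.m≤n⇒m≤1+n i≤j))) (f≡0 (suc j) ℕₚ.≤-refl)

sumTo-⊝ : ∀ j (f g : ℕ → ℚ) → sumTo j (λ i → f i + - g i) ≡ sumTo j f + - sumTo j g
sumTo-⊝ zero    f g = refl
sumTo-⊝ (suc j) f g = trans (cong (_+ (f (suc j) + - g (suc j))) (sumTo-⊝ j f g))
  (solve 4 (λ a b c d → (a :+ :- b) :+ (c :+ :- d) := (a :+ c) :+ :- (b :+ d)) refl
     (sumTo j f) (sumTo j g) (f (suc j)) (g (suc j)))

sumTo-suc : ∀ j (f : ℕ → ℚ) → sumTo (suc j) f ≡ f 0 + sumTo j (f ∘ suc)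
sumTo-suc zero    f = refl
sumTo-suc (suc j) f = trans (cong (_+ f (suc (suc j))) (sumTo-suc j f))
  (ℚₚ.+-assoc (f 0) (sumTo j (f ∘ suc)) (f (suc (suc j))))

⊛-congˡ : ∀ {f f′} g → f ≗ f′ → (f ⊛ g) ≗ (f′ ⊛ g)
⊛-congˡ g f≗f′ j = sumTo-cong j (λ i _ → cong (_· g (j ∸ i)) (f≗f′ i))

⊛-congʳ : ∀ f {g g′} → g ≗ g′ → (f ⊛ g) ≗ (f ⊛ g′)
⊛-congʳ f g≗g′ j = sumTo-cong j (λ i _ → cong (f i ·_) (g≗g′ (j ∸ i)))

⊛-⊝ˡ : ∀ f g h → ((f ⊝ g) ⊛ h) ≗ ((f ⊛ h) ⊝ (g ⊛ h))
⊛-⊝ˡ f g h j = trans (sumTo-cong j (λ i _ → distrib (f i) (g i) (h (j ∸ i)))) (sumTo-⊝ j _ _)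
  where
  distrib : ∀ a b c → (a + - b) · c ≡ a · c + - (b · c)
  distrib = solve 3 (λ a b c → (a :+ :- b) :* c := a :* c :+ :- (b :* c)) refl

⊛-⊝ʳ : ∀ f g h → (f ⊛ (g ⊝ h)) ≗ ((f ⊛ g) ⊝ (f ⊛ h))
⊛-⊝ʳ f g h j = trans (sumTo-cong j (λ i _ → distrib (f i) (g (j ∸ i)) (h (j ∸ i)))) (sumTo-⊝ j _ _)
  where
  distrib : ∀ a b c → a · (b + - c) ≡ a · b + - (a · c)
  distrib = solve 3 (λ a b c → a :* (b :+ :- c) := a :* b :+ :- (a :* c)) refl

⊛-shiftXˡ : ∀ f g → (shiftX f ⊛ g) ≗ shiftX (f ⊛ g)
⊛-shiftXˡ f g zero    = ℚₚ.*-zeroˡ (g 0)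
⊛-shiftXˡ f g (suc j) = trans (sumTo-suc j _)
  (trans (cong (_+ (f ⊛ g) j) (ℚₚ.*-zeroˡ (g (suc j)))) (ℚₚ.+-identityˡ _))

⊛-shiftXʳ : ∀ f g → (f ⊛ shiftX g) ≗ shiftX (f ⊛ g)
⊛-shiftXʳ f g zero    = ℚₚ.*-zeroʳ (f 0)
⊛-shiftXʳ f g (suc j) = begin
  sumTo j (λ i → f i · shiftX g (suc j ∸ i)) + f (suc j) · shiftX g (j ∸ j)
    ≡⟨ cong₂ _+_ (sumTo-cong j (λ i i≤j → cong (λ k → f i · shiftX g k) (ℕₚ.+-∸-assoc 1 i≤j)))
                 (cong (λ k → f (suc j) · shiftX g k) (ℕₚ.n∸n≡0 j)) ⟩
  (f ⊛ g) j + f (suc j) · 0ℚ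
    ≡⟨ cong ((f ⊛ g) j +_) (ℚₚ.*-zeroʳ (f (suc j))) ⟩
  (f ⊛ g) j + 0ℚ
    ≡⟨ ℚₚ.+-identityʳ _ ⟩
  (f ⊛ g) j ∎

⊛-constʳ : ∀ f c → (f ⊛ const c) ≗ scale c f
⊛-constʳ f c zero    = ℚₚ.*-comm (f 0) c
⊛-constʳ f c (suc j) = begin
  sumTo j (λ i → f i · const c (suc j ∸ i)) + f (suc j) · const c (j ∸ j)
    ≡⟨ cong₂ _+_ (sumTo-zero j (λ i i≤j → trans (cong (λ k → f i · const c k) (ℕₚ.+-∸-assoc 1 i≤j))
                                                  (ℚₚ.*-zeroʳ (f i))))
                 (cong (λ k → f (suc j) · const c k) (ℕₚ.n∸n≡0 j)) ⟩
  0ℚ + f (suc j) · c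
    ≡⟨ ℚₚ.+-identityˡ _ ⟩
  f (suc j) · c
    ≡⟨ ℚₚ.*-comm (f (suc j)) c ⟩
  c · f (suc j) ∎

⊛-identityˡ : ∀ h → (const 1ℚ ⊛ h) ≗ h
⊛-identityˡ h zero    = ℚₚ.*-identityˡ (h 0)
⊛-identityˡ h (suc j) = begin
  (const 1ℚ ⊛ h) (suc j)                           ≡⟨ sumTo-suc j _ ⟩
  1ℚ · h (suc j) + sumTo j (λ i → 0ℚ · h (j ∸ i))  ≡⟨ cong₂ _+_ (ℚₚ.*-identityˡ (h (suc j)))
                                                                (sumTo-zero j (λ i _ → ℚₚ.*-zeroˡ (h (j ∸ i)))) ⟩
  h (suc j) + 0ℚ                                   ≡⟨ ℚₚ.+-identityʳ _ ⟩
  h (suc j)                                        ∎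

shiftX^ : ℕ → Series → Series
shiftX^ zero    f = f
shiftX^ (suc k) f = shiftX (shiftX^ k f)

VanishesBelow : ℕ → Series → Set
VanishesBelow b f = ∀ j → j < b → f j ≡ 0ℚ

shiftX^-cong : ∀ k {f g} → f ≗ g → shiftX^ k f ≗ shiftX^ k g
shiftX^-cong zero    f≗g j       = f≗g j
shiftX^-cong (suc k) f≗g zero    = refl
shiftX^-cong (suc k) f≗g (suc j) = shiftX^-cong k f≗g j

shiftX^-⊕ : ∀ k f g → shiftX^ k (f ⊕ g) ≗ (shiftX^ k f ⊕ shiftX^ k g)
shiftX^-⊕ zero    f g j       = refl
shiftX^-⊕ (suc k) f g zero    = refl
shiftX^-⊕ (suc k) f g (suc j) = shiftX^-⊕ k f g j

shiftX^-⊝ : ∀ k f g → shiftX^ k (f ⊝ g) ≗ (shiftX^ k f ⊝ shiftX^ k g)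
shiftX^-⊝ zero    f g j       = refl
shiftX^-⊝ (suc k) f g zero    = refl
shiftX^-⊝ (suc k) f g (suc j) = shiftX^-⊝ k f g j

shiftX^-scale : ∀ k c f → shiftX^ k (scale c f) ≗ scale c (shiftX^ k f)
shiftX^-scale zero    c f j       = refl
shiftX^-scale (suc k) c f zero    = sym (ℚₚ.*-zeroʳ c)
shiftX^-scale (suc k) c f (suc j) = shiftX^-scale k c f j

shiftX^-shiftX : ∀ k f → shiftX^ k (shiftX f) ≗ shiftX^ (suc k) f
shiftX^-shiftX zero    f j = refl
shiftX^-shiftX (suc k) f   = shiftX^-cong 1 (shiftX^-shiftX k f)

shiftX^-vanishing : ∀ k {b f} → VanishesBelow b f → VanishesBelow (k ℕ.+ b) (shiftX^ k f)
shiftX^-vanishing zero    f≡0 j       j<b          = f≡0 j j<b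
shiftX^-vanishing (suc k) f≡0 zero    _            = refl
shiftX^-vanishing (suc k) f≡0 (suc j) (s≤s j<k+b) = shiftX^-vanishing k f≡0 j j<k+b

⊛-shiftX^ʳ : ∀ k f g → (f ⊛ shiftX^ k g) ≗ shiftX^ k (f ⊛ g)
⊛-shiftX^ʳ zero    f g j = refl
⊛-shiftX^ʳ (suc k) f g j = trans (⊛-shiftXʳ f (shiftX^ k g) j) (shiftX^-cong 1 (⊛-shiftX^ʳ k f g) j)

⊛-shiftX^ˡ : ∀ k f g → (shiftX^ k f ⊛ g) ≗ shiftX^ k (f ⊛ g)
⊛-shiftX^ˡ zero    f g j = refl
⊛-shiftX^ˡ (suc k) f g j = trans (⊛-shiftXˡ (shiftX^ k f) g j) (shiftX^-cong 1 (⊛-shiftX^ˡ k f g) j)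

-- Division of power series

module SeriesDivision (D : Series) (c : ℚ) (D₀·c≡1 : D 0 · c ≡ 1ℚ) where

  ·c·D₀ : ∀ x → (x · c) · D 0 ≡ x
  ·c·D₀ x = begin
    (x · c) · D 0 ≡⟨ solve 3 (λ x c d → (x :* c) :* d := x :* (d :* c)) refl x c (D 0) ⟩
    x · (D 0 · c) ≡⟨ cong (x ·_) D₀·c≡1 ⟩
    x · 1ℚ        ≡⟨ ℚₚ.*-identityʳ x ⟩
    x             ∎

  x·D₀≡0⇒x≡0 : ∀ x → x · D 0 ≡ 0ℚ → x ≡ 0ℚ
  x·D₀≡0⇒x≡0 x x·D₀≡0 = begin
    x             ≡⟨ ·c·D₀ x ⟨
    (x · c) · D 0 ≡⟨ solve 3 (λ x c d → (x :* c) :* d := (x :* d) :* c) refl x c (D 0) ⟩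
    (x · D 0) · c ≡⟨ cong (_· c) x·D₀≡0 ⟩
    0ℚ · c        ≡⟨ ℚₚ.*-zeroˡ c ⟩
    0ℚ            ∎

  ⊛-suc : ∀ h j → (h ⊛ D) (suc j) ≡ sumTo j (λ i → h i · D (suc j ∸ i)) + h (suc j) · D 0
  ⊛-suc h j = cong (λ k → sumTo j (λ i → h i · D (suc j ∸ i)) + h (suc j) · D k) (ℕₚ.n∸n≡0 j)

  ⊛-vanishing⇒vanishing : ∀ b h → VanishesBelow b (h ⊛ D) → VanishesBelow b h
  ⊛-vanishing⇒vanishing b h hD≡0 = <-rec (λ j → j < b → h j ≡ 0ℚ) step
    where
    step : ∀ j → (∀ {i} → i < j → i < b → h i ≡ 0ℚ) → j < b → h j ≡ 0ℚ
    step zero    _  0<b   = x·D₀≡0⇒x≡0 (h 0) (hD≡0 0 0<b)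
    step (suc j) ih 1+j<b = x·D₀≡0⇒x≡0 (h (suc j)) (begin
      h (suc j) · D 0
        ≡⟨ ℚₚ.+-identityˡ _ ⟨
      0ℚ + h (suc j) · D 0
        ≡⟨ cong (_+ h (suc j) · D 0) (sumTo-zero j (λ i i≤j →
             trans (cong (_· D (suc j ∸ i)) (ih (s≤s i≤j) (ℕₚ.<-trans (s≤s i≤j) 1+j<b)))
                   (ℚₚ.*-zeroˡ (D (suc j ∸ i))))) ⟨
      sumTo j (λ i → h i · D (suc j ∸ i)) + h (suc j) · D 0
        ≡⟨ ⊛-suc h j ⟨
      (h ⊛ D) (suc j)
        ≡⟨ hD≡0 (suc j) 1+j<b ⟩
      0ℚ ∎)

  -- approx j holds the quotient's coefficients up to degree j, in place of course-of-values recursion.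
  module Quotient (E : Series) where

    approx : ℕ → Series
    approx zero    k = E 0 · c
    approx (suc j) k with k ≤? j
    ... | yes _ = approx j k
    ... | no  _ = (E (suc j) + - sumTo j (λ i → approx j i · D (suc j ∸ i))) · c

    quotient : Series
    quotient k = approx k k

    approx-stable : ∀ {j k} → k ≤ j → approx j k ≡ quotient k
    approx-stable {zero}  z≤n = refl
    approx-stable {suc j} {k} k≤1+j with ℕₚ.m≤n⇒m<n∨m≡n k≤1+j
    ... | inj₂ refl = refl
    ... | inj₁ (s≤s k≤j) with k ≤? j
    ...   | yes _   = approx-stable k≤j
    ...   | no  k≰j = contradiction k≤j k≰j

    quotient-suc : ∀ j → quotient (suc j) ≡ (E (suc j) + - sumTo j (λ i → quotient i · D (suc j ∸ i))) · c
    quotient-suc j with suc j ≤? j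
    ... | yes 1+j≤j = contradiction 1+j≤j (ℕₚ.n≮n j)
    ... | no  _     = cong (λ s → (E (suc j) + - s) · c)
                           (sumTo-cong j (λ i i≤j → cong (_· D (suc j ∸ i)) (approx-stable i≤j)))

    quotient-⊛ : (quotient ⊛ D) ≗ E
    quotient-⊛ zero    = ·c·D₀ (E 0)
    quotient-⊛ (suc j) = begin
      (quotient ⊛ D) (suc j)                                   ≡⟨ ⊛-suc quotient j ⟩
      s + quotient (suc j) · D 0                               ≡⟨ cong (λ q → s + q · D 0) (quotient-suc j) ⟩
      s + ((E (suc j) + - s) · c) · D 0                        ≡⟨ cong (s +_) (·c·D₀ (E (suc j) + - s)) ⟩
      s + (E (suc j) + - s)                                    ≡⟨ solve 2 (λ s e → s :+ (e :+ :- s) := e) refl s (E (suc j)) ⟩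
      E (suc j)                                                ∎
      where
      s : ℚ
      s = sumTo j (λ i → quotient i · D (suc j ∸ i))

ChebyshevRecurrence : (ℕ → Series) → Set
ChebyshevRecurrence s = ∀ m → s (suc (suc m)) ≗ (s (suc m) ⊝ shiftX^ 2 (s m))

recurrence-⊝ : ∀ s t → ChebyshevRecurrence s → ChebyshevRecurrence t →
               ChebyshevRecurrence (λ m → s m ⊝ t m)
recurrence-⊝ s t rs rt m j = begin
  s (2 ℕ.+ m) j + - t (2 ℕ.+ m) j
    ≡⟨ cong₂ (λ x y → x + - y) (rs m j) (rt m j) ⟩
  (s (suc m) j + - shiftX^ 2 (s m) j) + - (t (suc m) j + - shiftX^ 2 (t m) j)
    ≡⟨ solve 4 (λ a b c d → (a :+ :- b) :+ :- (c :+ :- d) := (a :+ :- c) :+ :- (b :+ :- d)) refl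
         (s (suc m) j) (shiftX^ 2 (s m) j) (t (suc m) j) (shiftX^ 2 (t m) j) ⟩
  (s (suc m) j + - t (suc m) j) + - (shiftX^ 2 (s m) j + - shiftX^ 2 (t m) j)
    ≡⟨ cong (λ x → (s (suc m) j + - t (suc m) j) + - x) (shiftX^-⊝ 2 (s m) (t m) j) ⟨
  (s (suc m) j + - t (suc m) j) + - shiftX^ 2 (s m ⊝ t m) j ∎

recurrence-scale : ∀ c s → ChebyshevRecurrence s → ChebyshevRecurrence (λ m → scale c (s m))
recurrence-scale c s rs m j = begin
  c · s (2 ℕ.+ m) j                                  ≡⟨ cong (c ·_) (rs m j) ⟩
  c · (s (suc m) j + - shiftX^ 2 (s m) j)            ≡⟨ solve 3 (λ c a b → c :* (a :+ :- b) := c :* a :+ :- (c :* b)) refl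
                                                          c (s (suc m) j) (shiftX^ 2 (s m) j) ⟩
  c · s (suc m) j + - (c · shiftX^ 2 (s m) j)        ≡⟨ cong (λ x → c · s (suc m) j + - x) (shiftX^-scale 2 c (s m) j) ⟨
  c · s (suc m) j + - shiftX^ 2 (scale c (s m)) j    ∎

recurrence-⊛ˡ : ∀ f s → ChebyshevRecurrence s → ChebyshevRecurrence (λ m → f ⊛ s m)
recurrence-⊛ˡ f s rs m j = begin
  (f ⊛ s (2 ℕ.+ m)) j                                ≡⟨ ⊛-congʳ f (rs m) j ⟩
  (f ⊛ (s (suc m) ⊝ shiftX^ 2 (s m))) j              ≡⟨ ⊛-⊝ʳ f (s (suc m)) (shiftX^ 2 (s m)) j ⟩
  (f ⊛ s (suc m)) j + - (f ⊛ shiftX^ 2 (s m)) j      ≡⟨ cong (λ x → (f ⊛ s (suc m)) j + - x) (⊛-shiftX^ʳ 2 f (s m) j) ⟩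
  (f ⊛ s (suc m)) j + - shiftX^ 2 (f ⊛ s m) j        ∎

recurrence-unique : ∀ {s t} → ChebyshevRecurrence s → ChebyshevRecurrence t →
                    s 0 ≗ t 0 → s 1 ≗ t 1 → ∀ m → s m ≗ t m
recurrence-unique {s} {t} rs rt s₀≗t₀ s₁≗t₁ m = proj₁ (agree m)
  where
  agree : ∀ m → s m ≗ t m × s (suc m) ≗ t (suc m)
  agree zero    = s₀≗t₀ , s₁≗t₁
  agree (suc m) = let (sₘ≗tₘ , sₘ₊₁≗tₘ₊₁) = agree m in
    sₘ₊₁≗tₘ₊₁ , λ j → trans (rs m j)
      (trans (cong₂ (λ x y → x + - y) (sₘ₊₁≗tₘ₊₁ j) (shiftX^-cong 2 sₘ≗tₘ j)) (sym (rt m j)))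

clearedCheb : ℕ → Series
clearedCheb m = clearAt m (cheb m)

cheb-degree : ∀ m k → m < k → cheb m k ≡ 0ℚ
cheb-degree zero          (suc k)       _         = refl
cheb-degree (suc zero)    (suc zero)    (s≤s ())
cheb-degree (suc zero)    (suc (suc k)) _         = refl
cheb-degree (suc (suc m)) (suc k)       (s≤s m<k) rewrite cheb-degree (suc m) k m<k
                                                       | cheb-degree m (suc k) (ℕₚ.m≤n⇒m≤1+n (ℕₚ.<⇒≤ m<k)) = refl

clearAt-suc : ∀ d p j → clearAt (suc d) p (suc j) ≡ clearAt d p j
clearAt-suc d p zero    = refl
clearAt-suc d p (suc j) = refl

clearAt-shiftX : ∀ d p → p (suc d) ≡ 0ℚ → clearAt (suc d) p ≗ shiftX (clearAt d p)
clearAt-shiftX d p pₛd≡0 zero    = trans (cong (_· pow ½ (suc d)) pₛd≡0) (ℚₚ.*-zeroˡ (pow ½ (suc d)))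
clearAt-shiftX d p pₛd≡0 (suc j) = clearAt-suc d p j

clearAt-step : ∀ m q r j → clearAt (suc m) (scale two (shiftX q) ⊝ r) j ≡ clearAt m q j + - clearAt (suc m) r j
clearAt-step m q r zero =
  solve 3 (λ a b c → (con two :* a :+ :- b) :* (con ½ :* c) := a :* c :+ :- (b :* (con ½ :* c))) refl
    (q m) (r (suc m)) (pow ½ m)
clearAt-step zero    q r (suc zero)    =
  solve 1 (λ b → (con two :* con 0ℚ :+ :- b) :* con 1ℚ := con 0ℚ :+ :- (b :* con 1ℚ)) refl (r 0)
clearAt-step zero    q r (suc (suc j)) = refl
clearAt-step (suc m) q r (suc j)       = begin
  clearAt (2 ℕ.+ m) (scale two (shiftX q) ⊝ r) (suc j)     ≡⟨ clearAt-suc (suc m) (scale two (shiftX q) ⊝ r) j ⟩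
  clearAt (suc m) (scale two (shiftX q) ⊝ r) j             ≡⟨ clearAt-step m q r j ⟩
  clearAt m q j + - clearAt (suc m) r j                    ≡⟨ cong₂ (λ x y → x + - y) (clearAt-suc m q j) (clearAt-suc (suc m) r j) ⟨
  clearAt (suc m) q (suc j) + - clearAt (2 ℕ.+ m) r (suc j) ∎

clearedCheb-recurrence : ChebyshevRecurrence clearedCheb
clearedCheb-recurrence m j = begin
  clearedCheb (2 ℕ.+ m) j                                   ≡⟨ clearAt-step (suc m) (cheb (suc m)) (cheb m) j ⟩
  clearedCheb (suc m) j + - clearAt (2 ℕ.+ m) (cheb m) j    ≡⟨ cong (λ x → clearedCheb (suc m) j + - x) lift ⟩
  clearedCheb (suc m) j + - shiftX^ 2 (clearedCheb m) j     ∎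
  where
  lift : clearAt (2 ℕ.+ m) (cheb m) j ≡ shiftX^ 2 (clearedCheb m) j
  lift = trans (clearAt-shiftX (suc m) (cheb m) (cheb-degree m _ (ℕₚ.m<n⇒m<1+n (ℕₚ.n<1+n m))) j)
               (shiftX^-cong 1 (clearAt-shiftX m (cheb m) (cheb-degree m _ (ℕₚ.n<1+n m))) j)

clearedCheb₀ : clearedCheb 0 ≗ const 1ℚ
clearedCheb₀ zero    = refl
clearedCheb₀ (suc j) = refl

clearedCheb₁ : clearedCheb 1 ≗ const ½
clearedCheb₁ zero          = refl
clearedCheb₁ (suc zero)    = refl
clearedCheb₁ (suc (suc j)) = refl

clearedCheb-suc-zero : ∀ m → clearedCheb (suc m) 0 ≡ ½
clearedCheb-suc-zero zero    = refl
clearedCheb-suc-zero (suc m) =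
  trans (clearedCheb-recurrence m 0) (trans (ℚₚ.+-identityʳ _) (clearedCheb-suc-zero m))

-- Bracket words

closingCount : ℕ → ℕ → ℕ
closingCount L d = length (filter (λ w → T? (balancedFrom d w)) (words L))

length-filter-map : ∀ {a b p} {A : Set a} {B : Set b} {P : Pred B p} (P? : Decidable P) (f : A → B) xs →
                    length (filter P? (map f xs)) ≡ length (filter (P? ∘ f) xs)
length-filter-map P? f []       = refl
length-filter-map P? f (x ∷ xs) with does (P? (f x))
... | true  = cong suc (length-filter-map P? f xs)
... | false = length-filter-map P? f xs

closingCount-suc : ∀ L d → closingCount (suc L) d ≡
  length (filter (λ w → T? (balancedFrom d (true ∷ w))) (words L)) ℕ.+
  length (filter (λ w → T? (balancedFrom d (false ∷ w))) (words L))
closingCount-suc L d = begin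
  length (filter P? (map (true ∷_) (words L) ++ map (false ∷_) (words L)))
    ≡⟨ cong length (Listₚ.filter-++ P? (map (true ∷_) (words L)) (map (false ∷_) (words L))) ⟩
  length (filter P? (map (true ∷_) (words L)) ++ filter P? (map (false ∷_) (words L)))
    ≡⟨ Listₚ.length-++ (filter P? (map (true ∷_) (words L))) ⟩
  length (filter P? (map (true ∷_) (words L))) ℕ.+ length (filter P? (map (false ∷_) (words L)))
    ≡⟨ cong₂ ℕ._+_ (length-filter-map P? (true ∷_) (words L)) (length-filter-map P? (false ∷_) (words L)) ⟩
  _ ∎
  where
  P? : Decidable (λ w → T (balancedFrom d w))
  P? w = T? (balancedFrom d w)

closingCount-suc-zero : ∀ L → closingCount (suc L) 0 ≡ closingCount L 1
closingCount-suc-zero L = begin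
  closingCount (suc L) 0           ≡⟨ closingCount-suc L 0 ⟩
  closingCount L 1 ℕ.+ length none ≡⟨ cong (λ ws → closingCount L 1 ℕ.+ length ws)
                                        (Listₚ.filter-none (λ w → T? (balancedFrom 0 (false ∷ w)))
                                                           (All.universal (λ _ ()) (words L))) ⟩
  closingCount L 1 ℕ.+ 0           ≡⟨ ℕₚ.+-identityʳ _ ⟩
  closingCount L 1                 ∎
  where
  none : List (List Bool)
  none = filter (λ w → T? (balancedFrom 0 (false ∷ w))) (words L)

closingCount-suc-suc : ∀ L d → closingCount (suc L) (suc d) ≡ closingCount L (suc (suc d)) ℕ.+ closingCount L d
closingCount-suc-suc L d = closingCount-suc L (suc d)

closingCount-vanishing : ∀ L d → L < d → closingCount L d ≡ 0
closingCount-vanishing zero    (suc d) _         = refl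
closingCount-vanishing (suc L) (suc d) (s≤s L<d) = trans (closingCount-suc-suc L d)
  (cong₂ ℕ._+_ (closingCount-vanishing L (suc (suc d)) (ℕₚ.m<n⇒m<1+n (ℕₚ.m<n⇒m<1+n L<d)))
               (closingCount-vanishing L d L<d))

parity-suc-injective : ∀ m n → parity (suc m) ≡ parity (suc n) → parity m ≡ parity n
parity-suc-injective m n e = trans (sym (ℙₚ.suc-homo-⁻¹ m)) (trans (cong _⁻¹ e) (ℙₚ.suc-homo-⁻¹ n))

closingCount-parity : ∀ L d → parity L ≡ parity (suc d) → closingCount L d ≡ 0
closingCount-parity zero    zero    ()
closingCount-parity zero    (suc d) _ = refl
closingCount-parity (suc L) zero    e =
  trans (closingCount-suc-zero L) (closingCount-parity L 1 (parity-suc-injective L 0 e))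
closingCount-parity (suc L) (suc d) e = trans (closingCount-suc-suc L d)
  (cong₂ ℕ._+_ (closingCount-parity L (suc (suc d)) e′) (closingCount-parity L d e′))
  where
  e′ : parity L ≡ parity (suc d)
  e′ = parity-suc-injective L (suc d) e

parity-odd : ∀ k → parity (suc (k ℕ.+ k)) ≡ 1ℙ
parity-odd zero    = refl
parity-odd (suc k) = trans (cong parity (ℕₚ.+-suc k k)) (parity-odd k)

closingSeries : ℕ → Series
closingSeries d L = toℚ (closingCount L d)

closingSeries-vanishing : ∀ d → VanishesBelow d (closingSeries d)
closingSeries-vanishing d L L<d = cong toℚ (closingCount-vanishing L d L<d)

closingSeries-zero : closingSeries 0 ≗ (const 1ℚ ⊕ shiftX (closingSeries 1))
closingSeries-zero zero    = refl
closingSeries-zero (suc L) = trans (cong toℚ (closingCount-suc-zero L)) (sym (ℚₚ.+-identityˡ _))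

closingSeries-suc : ∀ d → closingSeries (suc d) ≗ (shiftX (closingSeries (suc (suc d))) ⊕ shiftX (closingSeries d))
closingSeries-suc d zero    = refl
closingSeries-suc d (suc L) = trans (cong toℚ (closingCount-suc-suc L d)) (toℚ-+ (closingCount L (suc (suc d))) (closingCount L d))

evenSeries-≗ : ∀ f G → (∀ k → f k ≡ G (k ℕ.+ k)) → (∀ k → G (suc (k ℕ.+ k)) ≡ 0ℚ) → evenSeries f ≗ G
evenSeries-≗ f G f≡G G-odd zero          = f≡G 0
evenSeries-≗ f G f≡G G-odd (suc zero)    = sym (G-odd 0)
evenSeries-≗ f G f≡G G-odd (suc (suc j)) = evenSeries-≗ (f ∘ suc) (G ∘ suc ∘ suc)
  (λ k → trans (f≡G (suc k)) (cong (G ∘ suc) (ℕₚ.+-suc k k)))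
  (λ k → trans (cong (G ∘ suc ∘ suc) (sym (ℕₚ.+-suc k k))) (G-odd (suc k)))
  j

catalanSeries-closing : catalanSeries ≗ (const 1ℚ ⊝ shiftX^ 2 (closingSeries 0))
catalanSeries-closing zero          = refl
catalanSeries-closing (suc zero)    = refl
catalanSeries-closing (suc (suc j)) = trans
  (cong -_ (evenSeries-≗ _ (closingSeries 0) (λ _ → refl) closingSeries-odd j))
  (sym (ℚₚ.+-identityˡ _))
  where
  closingSeries-odd : ∀ k → closingSeries 0 (suc (k ℕ.+ k)) ≡ 0ℚ
  closingSeries-odd k = cong toℚ (closingCount-parity (suc (k ℕ.+ k)) 0 (parity-odd k))

shiftedClosing : ℕ → Series
shiftedClosing m = shiftX^ m (closingSeries m)

shiftedClosing-recurrence : ChebyshevRecurrence shiftedClosing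
shiftedClosing-recurrence m j = begin
  shiftedClosing (2 ℕ.+ m) j
    ≡⟨ solve 2 (λ a b → a := (a :+ b) :+ :- b) refl (shiftedClosing (2 ℕ.+ m) j) (shiftX^ 2 (shiftedClosing m) j) ⟩
  (shiftedClosing (2 ℕ.+ m) j + shiftX^ 2 (shiftedClosing m) j) + - shiftX^ 2 (shiftedClosing m) j
    ≡⟨ cong (_+ - shiftX^ 2 (shiftedClosing m) j) split ⟨
  shiftedClosing (suc m) j + - shiftX^ 2 (shiftedClosing m) j ∎
  where
  split : shiftedClosing (suc m) j ≡ shiftedClosing (2 ℕ.+ m) j + shiftX^ 2 (shiftedClosing m) j
  split = begin
    shiftX^ (suc m) (closingSeries (suc m)) j
      ≡⟨ shiftX^-cong (suc m) (closingSeries-suc m) j ⟩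
    shiftX^ (suc m) (shiftX (closingSeries (2 ℕ.+ m)) ⊕ shiftX (closingSeries m)) j
      ≡⟨ shiftX^-⊕ (suc m) _ _ j ⟩
    shiftX^ (suc m) (shiftX (closingSeries (2 ℕ.+ m))) j + shiftX^ (suc m) (shiftX (closingSeries m)) j
      ≡⟨ cong₂ _+_ (shiftX^-shiftX (suc m) _ j) (shiftX^-shiftX (suc m) _ j) ⟩
    shiftedClosing (2 ℕ.+ m) j + shiftX^ 2 (shiftedClosing m) j ∎

discrepancy : ℕ → Series
discrepancy m = (closingSeries 0 ⊛ clearedCheb (suc m)) ⊝ clearedCheb m

discrepancy-closedForm : ∀ m → discrepancy m ≗ (shiftedClosing (suc m) ⊝ scale ½ (shiftedClosing m))
discrepancy-closedForm = recurrence-unique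
  (recurrence-⊝ (λ m → g₀ ⊛ clearedCheb (suc m)) clearedCheb
    (recurrence-⊛ˡ g₀ (clearedCheb ∘ suc) (clearedCheb-recurrence ∘ suc)) clearedCheb-recurrence)
  (recurrence-⊝ (shiftedClosing ∘ suc) (scale ½ ∘ shiftedClosing)
    (shiftedClosing-recurrence ∘ suc) (recurrence-scale ½ shiftedClosing shiftedClosing-recurrence))
  base₀ base₁
  where
  g₀ : Series
  g₀ = closingSeries 0

  g₀⊛E₀ : (g₀ ⊛ clearedCheb 0) ≗ g₀
  g₀⊛E₀ j = trans (⊛-congʳ g₀ clearedCheb₀ j) (trans (⊛-constʳ g₀ 1ℚ j) (ℚₚ.*-identityˡ (g₀ j)))

  g₀⊛E₁ : (g₀ ⊛ clearedCheb 1) ≗ scale ½ g₀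
  g₀⊛E₁ j = trans (⊛-congʳ g₀ clearedCheb₁ j) (⊛-constʳ g₀ ½ j)

  base₀ : discrepancy 0 ≗ (shiftedClosing 1 ⊝ scale ½ (shiftedClosing 0))
  base₀ j = begin
    (g₀ ⊛ clearedCheb 1) j + - clearedCheb 0 j  ≡⟨ cong₂ (λ x y → x + - y) (g₀⊛E₁ j) (clearedCheb₀ j) ⟩
    ½ · g₀ j + - a                              ≡⟨ cong (λ x → ½ · x + - a) (closingSeries-zero j) ⟩
    ½ · (a + s) + - a                           ≡⟨ solve 2 (λ a s → con ½ :* (a :+ s) :+ :- a :=
                                                                s :+ :- (con ½ :* (a :+ s))) refl a s ⟩
    s + - (½ · (a + s))                         ≡⟨ cong (λ x → s + - (½ · x)) (closingSeries-zero j) ⟨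
    s + - (½ · g₀ j)                            ∎
    where
    a s : ℚ
    a = const 1ℚ j
    s = shiftX (closingSeries 1) j

  base₁ : discrepancy 1 ≗ (shiftedClosing 2 ⊝ scale ½ (shiftedClosing 1))
  base₁ j = begin
    (g₀ ⊛ clearedCheb 2) j + - clearedCheb 1 j
      ≡⟨ cong₂ (λ x y → x + - y) g₀⊛E₂ (trans (clearedCheb₁ j) (const-½ j)) ⟩
    (½ · g₀ j + - c) + - (½ · a)
      ≡⟨ cong (λ x → (½ · x + - c) + - (½ · a)) (closingSeries-zero j) ⟩
    (½ · (a + s) + - c) + - (½ · a)
      ≡⟨ cong (λ x → (½ · (a + x) + - c) + - (½ · a)) s≡b+c ⟩
    (½ · (a + (b + c)) + - c) + - (½ · a)
      ≡⟨ solve 3 (λ a b c → (con ½ :* (a :+ (b :+ c)) :+ :- c) :+ :- (con ½ :* a) :=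
                            b :+ :- (con ½ :* (b :+ c))) refl a b c ⟩
    b + - (½ · (b + c))
      ≡⟨ cong (λ x → b + - (½ · x)) s≡b+c ⟨
    b + - (½ · s) ∎
    where
    a b c s : ℚ
    a = const 1ℚ j
    b = shiftX^ 2 (closingSeries 2) j
    c = shiftX^ 2 g₀ j
    s = shiftX (closingSeries 1) j
    const-½ : ∀ j → const ½ j ≡ ½ · const 1ℚ j
    const-½ zero    = refl
    const-½ (suc j) = refl
    s≡b+c : s ≡ b + c
    s≡b+c = trans (shiftX^-cong 1 (closingSeries-suc 0) j) (shiftX^-⊕ 1 _ _ j)
    g₀⊛E₂ : (g₀ ⊛ clearedCheb 2) j ≡ ½ · g₀ j + - c
    g₀⊛E₂ = trans (recurrence-⊛ˡ g₀ clearedCheb clearedCheb-recurrence 0 j)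
                  (cong₂ (λ x y → x + - y) (g₀⊛E₁ j) (shiftX^-cong 2 g₀⊛E₀ j))

discrepancy-vanishing : ∀ m → VanishesBelow (m ℕ.+ m) (discrepancy m)
discrepancy-vanishing m j j<m+m = trans (discrepancy-closedForm m j)
  (cong₂ (λ x y → x + - (½ · y))
    (shiftX^-vanishing (suc m) (closingSeries-vanishing (suc m)) j
      (ℕₚ.<-≤-trans j<m+m (ℕₚ.+-mono-≤ (ℕₚ.n≤1+n m) (ℕₚ.n≤1+n m))))
    (shiftX^-vanishing m (closingSeries-vanishing m) j j<m+m))

catalan-⊛-clearedCheb : ∀ m →
  (clearedCheb (2 ℕ.+ m) ⊝ (catalanSeries ⊛ clearedCheb (suc m))) ≗ shiftX^ 2 (discrepancy m)
catalan-⊛-clearedCheb m j = begin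
  clearedCheb (2 ℕ.+ m) j + - (catalanSeries ⊛ E) j
    ≡⟨ cong₂ (λ x y → x + - y) (clearedCheb-recurrence m j) catalan⊛E ⟩
  (E j + - b) + - (E j + - a)
    ≡⟨ solve 3 (λ e a b → (e :+ :- b) :+ :- (e :+ :- a) := a :+ :- b) refl (E j) a b ⟩
  a + - b
    ≡⟨ shiftX^-⊝ 2 (g₀ ⊛ E) (clearedCheb m) j ⟨
  shiftX^ 2 (discrepancy m) j ∎
  where
  E g₀ : Series
  E  = clearedCheb (suc m)
  g₀ = closingSeries 0
  a b : ℚ
  a  = shiftX^ 2 (g₀ ⊛ E) j
  b  = shiftX^ 2 (clearedCheb m) j
  catalan⊛E : (catalanSeries ⊛ E) j ≡ E j + - a
  catalan⊛E = begin
    (catalanSeries ⊛ E) j                          ≡⟨ ⊛-congˡ E catalanSeries-closing j ⟩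
    ((const 1ℚ ⊝ shiftX^ 2 g₀) ⊛ E) j              ≡⟨ ⊛-⊝ˡ (const 1ℚ) (shiftX^ 2 g₀) E j ⟩
    (const 1ℚ ⊛ E) j + - (shiftX^ 2 g₀ ⊛ E) j      ≡⟨ cong₂ (λ x y → x + - y) (⊛-identityˡ E j) (⊛-shiftX^ˡ 2 g₀ E j) ⟩
    E j + - a                                      ∎

2*[2+m]∸4≡m+m : ∀ m → 2 * suc (suc m) ∸ 4 ≡ m ℕ.+ m
2*[2+m]∸4≡m+m m = begin
  2 * (2 ℕ.+ m) ∸ 4        ≡⟨ cong (_∸ 4) (ℕₚ.*-distribˡ-+ 2 2 m) ⟩
  (4 ℕ.+ 2 * m) ∸ 4        ≡⟨ ℕₚ.m+n∸m≡n 4 (2 * m) ⟩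
  m ℕ.+ (m ℕ.+ 0)          ≡⟨ cong (m ℕ.+_) (ℕₚ.+-identityʳ m) ⟩
  m ℕ.+ m                  ∎

expansion-catalan-vanishing : ∀ m F → (F ⊛ clearedCheb (suc m)) ≗ clearedCheb (2 ℕ.+ m) →
  VanishesBelow (2 ℕ.+ (m ℕ.+ m)) ((F ⊝ catalanSeries) ⊛ clearedCheb (suc m))
expansion-catalan-vanishing m F F-expands j j<2+2m = begin
  ((F ⊝ catalanSeries) ⊛ E) j                        ≡⟨ ⊛-⊝ˡ F catalanSeries E j ⟩
  (F ⊛ E) j + - (catalanSeries ⊛ E) j                ≡⟨ cong (_+ - (catalanSeries ⊛ E) j) (F-expands j) ⟩
  clearedCheb (2 ℕ.+ m) j + - (catalanSeries ⊛ E) j  ≡⟨ catalan-⊛-clearedCheb m j ⟩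
  shiftX^ 2 (discrepancy m) j                        ≡⟨ shiftX^-vanishing 2 (discrepancy-vanishing m) j j<2+2m ⟩
  0ℚ                                                 ∎
  where
  E : Series
  E = clearedCheb (suc m)

theorem1 : (n : ℕ) → 1 < n →
    Σ Series (IsExpansionOfG n) × ((F : Series) → IsExpansionOfG n F →
      (j : ℕ) → j ≤ 2 * n ∸ 4 → F j ≡ catalanSeries j)
theorem1 (suc zero)    (s≤s ())
theorem1 (suc (suc m)) _ = (quotient , quotient-⊛) , agree
  where
  open SeriesDivision (clearedCheb (suc m)) two (cong (_· two) (clearedCheb-suc-zero m))
  open Quotient (clearedCheb (2 ℕ.+ m))

  agree : (F : Series) → IsExpansionOfG (2 ℕ.+ m) F → (j : ℕ) → j ≤ 2 * (2 ℕ.+ m) ∸ 4 → F j ≡ catalanSeries j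
  agree F F-expands j j≤2n-4 = x∙y⁻¹≈ε⇒x≈y (F j) (catalanSeries j)
    (⊛-vanishing⇒vanishing (2 ℕ.+ (m ℕ.+ m)) (F ⊝ catalanSeries) (expansion-catalan-vanishing m F F-expands) j
      (s≤s (ℕₚ.m≤n⇒m≤1+n (subst (j ≤_) (2*[2+m]∸4≡m+m m) j≤2n-4))))
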